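{- Let $b^{e}(n)$ be the number of partitions of $n$ with initial 2-repetitions in which either all parts are distinct or the largest repeated part is even, and let $b^{o}(n)$ be the number of partitions of $n$ with initial 2-repetitions in which at least one part is repeated and the largest repeated part is odd. Then for all $n\ge 0$, $$b^{e}(n) - b^{o}(n) = \begin{cases} 1, & \text{if } n=\frac{j(j+1)}{2} \text{ for some integer } j\ge 0,\\ 0, & \text{otherwise}.\end{cases}$$
   Context: A partition of $n$ is a non-increasing finite sequence of positive integers (parts) summing to $n$; the empty partition is the unique partition of $0$. A part is repeated if it occurs at least twice. A partition has initial 2-repetitions if whenever a positive integer $j$ occurs as a part at least twice, every positive integer less than $j$ also occurs as a part at least twice. -}

module Defs where

open import Data.Nat using (ℕ; zero; suc; _+_; _*_; _≤ᵇ_; _≡ᵇ_)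
open import Data.Nat.Properties using ()
open import Data.Bool using (Bool; true; false; _∧_; _∨_; not; if_then_else_)
open import Data.List using (List; []; _∷_; map; concatMap; upTo; foldr)

allᵇ : {A : Set} → (A → Bool) → List A → Bool
allᵇ p []       = true
allᵇ p (x ∷ xs) = p x ∧ allᵇ p xs

anyᵇ : {A : Set} → (A → Bool) → List A → Bool
anyᵇ p []       = false
anyᵇ p (x ∷ xs) = p x ∨ anyᵇ p xs

filterᵇ : {A : Set} → (A → Bool) → List A → List A
filterᵇ p []       = []
filterᵇ p (x ∷ xs) = if p x then x ∷ filterᵇ p xs else filterᵇ p xs

sumℕ : List ℕ → ℕ
sumℕ = foldr _+_ 0
open import Data.Integer using (ℤ; +_; _-_)
open import Relation.Nullary.Decidable using (does)
open import Relation.Nullary using (Dec; yes; no)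
open import Relation.Binary.PropositionalEquality using (_≡_; refl)
open import Data.Product using (∃; _,_)
open import Data.Nat.Divisibility using ()

allPositive : List ℕ → Bool
allPositive = allᵇ (λ x → 1 ≤ᵇ x)

nonIncreasing : List ℕ → Bool
nonIncreasing []           = true
nonIncreasing (x ∷ [])     = true
nonIncreasing (x ∷ y ∷ xs) = (y ≤ᵇ x) ∧ nonIncreasing (y ∷ xs)

isPartitionOf : ℕ → List ℕ → Bool
isPartitionOf n λs = allPositive λs ∧ nonIncreasing λs ∧ (sumℕ λs ≡ᵇ n)

occ : ℕ → List ℕ → ℕ
occ j []       = 0
occ j (x ∷ xs) = if j ≡ᵇ x then suc (occ j xs) else occ j xs

repeated : List ℕ → ℕ → Bool
repeated λs j = 2 ≤ᵇ occ j λs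

oneTo : ℕ → List ℕ
oneTo m = map suc (upTo m)

-- initial 2-repetitions: whenever a positive j occurs at least twice,
-- every positive i < j occurs at least twice.  Only parts j can occur,
-- so it suffices to range j over the parts of the partition.
initial2Reps : List ℕ → Bool
initial2Reps λs =
  allᵇ (λ j → not (repeated λs j) ∨ allᵇ (repeated λs) (map suc (upTo (j Data.Nat.∸ 1)))) λs
  where import Data.Nat

hasRepeated : List ℕ → Bool
hasRepeated λs = anyᵇ (repeated λs) λs

-- the largest repeated part (0 if there is none)
maxRep : List ℕ → ℕ
maxRep λs = foldr (λ x m → if repeated λs x ∧ (m ≤ᵇ x) then x else m) 0 λs

even? : ℕ → Bool
even? zero          = true
even? (suc zero)    = false
even? (suc (suc k)) = even? k

listsUpTo : ℕ → ℕ → List (List ℕ)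
listsUpTo zero    m = [] ∷ []
listsUpTo (suc k) m = [] ∷ concatMap (λ x → map (x ∷_) (listsUpTo k m)) (oneTo m)

-- All partitions of n (every partition of n has at most n parts, each ≤ n,
-- so it appears exactly once among the candidates).
partitions : ℕ → List (List ℕ)
partitions n = filterᵇ (isPartitionOf n) (listsUpTo n n)

bE-cond : List ℕ → Bool
bE-cond λs = initial2Reps λs ∧ (not (hasRepeated λs) ∨ even? (maxRep λs))

bO-cond : List ℕ → Bool
bO-cond λs = initial2Reps λs ∧ hasRepeated λs ∧ not (even? (maxRep λs))

countBy : (List ℕ → Bool) → List (List ℕ) → ℕ
countBy p []       = 0
countBy p (x ∷ xs) = if p x then suc (countBy p xs) else countBy p xs

bE : ℕ → ℕ
bE n = countBy bE-cond (partitions n)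

bO : ℕ → ℕ
bO n = countBy bO-cond (partitions n)

Triangular : ℕ → Set
Triangular n = ∃ λ (j : ℕ) → 2 * n ≡ j * (j + 1)

-- A sign-reversing involution in the style of Franklin's.  Let λ have initial
-- 2-repetitions with largest repeated part k.  If its largest part is at most its
-- number of parts, move the first column of its Ferrers diagram into a new first row;
-- otherwise move the first row into a new first column.  Both moves preserve initial
-- 2-repetitions, the first lowers k by one and the second raises it by one, and each
-- undoes the other, so the b^e and b^o partitions are paired off.  The moves are made
-- on every partition with initial 2-repetitions except the staircases (j, j - 1, …, 1),
-- which are counted by b^e; there is one of size n exactly when n = j(j+1)/2.

module Submission where

open import Defs
open import Data.Bool using (Bool; true; false; T; _∧_; _∨_; not; if_then_else_)
open import Data.Bool.Properties using (T-∧; T-≡; ∧-zeroʳ; ∧-identityʳ; ∨-zeroʳ; not-involutive)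
open import Data.Empty using (⊥-elim)
open import Data.Integer using (+_; _-_)
open import Data.Integer.Properties using ([+m]-[+n]≡m⊖n; ⊖-≥)
open import Data.List
  using (List; []; _∷_; _++_; map; length; replicate; foldr; filter; upTo; concatMap; cartesianProductWith)
open import Data.List.Membership.Propositional using (_∈_; _∉_)
open import Data.List.Membership.Propositional.Properties
  using (∈-map⁺; ∈-map⁻; ∈-upTo⁺; ∈-upTo⁻; ∈-filter⁺; ∈-filter⁻; ∈-∃++; ∈-++⁻; ∈-++⁺ˡ; ∈-++⁺ʳ;
         ∈-cartesianProductWith⁺; ∈-cartesianProductWith⁻)
open import Data.List.Membership.Propositional.Properties.WithK using (unique∧set⇒bag)
open import Data.List.Properties
  using (∷-injective; ≡-dec; length-++; length-++-sucʳ; length-map; length-replicate; length-upTo; ++-identityʳ)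
open import Data.List.Relation.Binary.BagAndSetEquality using (∼bag⇒↭)
open import Data.List.Relation.Binary.Permutation.Propositional using (_↭_)
open import Data.List.Relation.Binary.Permutation.Propositional.Properties using (↭-length; filter-↭)
open import Data.List.Relation.Binary.Subset.Propositional using (_⊆_)
open import Data.List.Relation.Unary.All as All using (All; []; _∷_)
import Data.List.Relation.Unary.All.Properties as All
open import Data.List.Relation.Unary.Any using (here; there)
open import Data.List.Relation.Unary.Linked as Linked using (Linked; []; [-]; _∷_)
open import Data.List.Relation.Unary.Linked.Properties using (Linked⇒All)
open import Data.List.Relation.Unary.Unique.Propositional using (Unique; []; _∷_)
import Data.List.Relation.Unary.Unique.Propositional.Properties as Unique
open import Data.Nat using (ℕ; zero; suc; _+_; _*_; _∸_; _≤_; _<_; _≥_; _>_; z≤n; s≤s; _≤ᵇ_; _≡ᵇ_)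
open import Data.Nat.ListAction.Properties using (sum-++)
open import Data.Nat.Properties
open import Data.Nat.Solver using (module +-*-Solver)
open import Data.Product using (_×_; _,_; proj₂)
open import Data.Sum using (_⊎_; inj₁; inj₂; map₂)
open import Data.Unit using (tt)
open import Function using (_∘_; _∘′_; flip; Equivalence; mk⇔)
open import Relation.Binary.Definitions using (Transitive; tri<; tri≈; tri>)
open import Relation.Binary.PropositionalEquality
open import Relation.Nullary using (¬_; T?; does; proof; yes; no; contradiction)
open import Relation.Nullary.Decidable using (dec-true)
open import Relation.Nullary.Reflects using (Reflects; ofʸ; ofⁿ)
open import Algebra.Properties.CommutativeSemigroup +-commutativeSemigroup using (x∙yz≈y∙xz; xy∙z≈xz∙y)

open Equivalence using (to; from)

Linked⇒All-tail : {A : Set} {R : A → A → Set} → Transitive R → {x : A} {xs : List A} →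
                  Linked R (x ∷ xs) → All (R x) xs
Linked⇒All-tail trans [-]          = []
Linked⇒All-tail trans (Rxy ∷ Ryys) = Linked⇒All trans Rxy Ryys

unique⊆⇒length≤ : {A : Set} {xs ys : List A} → Unique xs → xs ⊆ ys → length xs ≤ length ys
unique⊆⇒length≤ [] _ = z≤n
unique⊆⇒length≤ {xs = x ∷ xs} (x∉xs ∷ uxs) x∷xs⊆ys
  with as , bs , refl ← ∈-∃++ (x∷xs⊆ys (here refl)) =
  ≤-trans (s≤s (unique⊆⇒length≤ uxs xs⊆as++bs)) (≤-reflexive (sym (length-++-sucʳ as x bs)))
  where
  xs⊆as++bs : xs ⊆ as ++ bs
  xs⊆as++bs y∈xs with ∈-++⁻ as (x∷xs⊆ys (there y∈xs))
  ... | inj₁ y∈as         = ∈-++⁺ˡ y∈as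
  ... | inj₂ (here refl)  = contradiction refl (All.lookup x∉xs y∈xs)
  ... | inj₂ (there y∈bs) = ∈-++⁺ʳ as y∈bs

map⁺-injectiveOn : {A B : Set} (f : A → B) {xs : List A} →
                   (∀ {x y} → x ∈ xs → y ∈ xs → f x ≡ f y → x ≡ y) → Unique xs → Unique (map f xs)
map⁺-injectiveOn f inj []           = []
map⁺-injectiveOn f inj (x∉xs ∷ uxs) =
  All.map⁺ (All.tabulate λ y∈xs fx≡fy → All.lookup x∉xs y∈xs (inj (here refl) (there y∈xs) fx≡fy))
  ∷ map⁺-injectiveOn f (λ x∈ y∈ → inj (there x∈) (there y∈)) uxs

map-involution-↭ : {A : Set} (f : A → A) {xs : List A} → Unique xs →
                   (∀ {x} → x ∈ xs → f x ∈ xs) → (∀ {x} → x ∈ xs → f (f x) ≡ x) → map f xs ↭ xs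
map-involution-↭ f {xs} uxs closed involutive =
  ∼bag⇒↭ (unique∧set⇒bag (map⁺-injectiveOn f injective uxs) uxs (mk⇔ image⊆xs xs⊆image))
  where
  injective : ∀ {x y} → x ∈ xs → y ∈ xs → f x ≡ f y → x ≡ y
  injective x∈ y∈ fx≡fy = trans (sym (involutive x∈)) (trans (cong f fx≡fy) (involutive y∈))
  image⊆xs : map f xs ⊆ xs
  image⊆xs y∈ with _ , x∈ , refl ← ∈-map⁻ f y∈ = closed x∈
  xs⊆image : xs ⊆ map f xs
  xs⊆image y∈ = subst (_∈ map f xs) (involutive y∈) (∈-map⁺ f (closed y∈))

concatMap≡cartesianProductWith : {A B C : Set} (f : A → B → C) (xs : List A) (ys : List B) →
                                 concatMap (λ x → map (f x) ys) xs ≡ cartesianProductWith f xs ys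
concatMap≡cartesianProductWith f []       ys = refl
concatMap≡cartesianProductWith f (x ∷ xs) ys =
  cong (map (f x) ys ++_) (concatMap≡cartesianProductWith f xs ys)

filterᵇ≡filter : {A : Set} (p : A → Bool) (xs : List A) → filterᵇ p xs ≡ filter (T? ∘ p) xs
filterᵇ≡filter p []       = refl
filterᵇ≡filter p (x ∷ xs) with p x
... | true  = cong (x ∷_) (filterᵇ≡filter p xs)
... | false = filterᵇ≡filter p xs

allᵇ⁻ : {A : Set} (p : A → Bool) {xs : List A} → T (allᵇ p xs) → All (T ∘ p) xs
allᵇ⁻ p {[]}     _ = []
allᵇ⁻ p {x ∷ xs} t = let px , pxs = to (T-∧ {p x}) t in px ∷ allᵇ⁻ p pxs

allᵇ⁺ : {A : Set} (p : A → Bool) {xs : List A} → All (T ∘ p) xs → T (allᵇ p xs)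
allᵇ⁺ p []         = tt
allᵇ⁺ p (px ∷ pxs) = from T-∧ (px , allᵇ⁺ p pxs)

anyᵇ⁺ : {A : Set} (p : A → Bool) {x : A} {xs : List A} → x ∈ xs → T (p x) → T (anyᵇ p xs)
anyᵇ⁺ p {xs = y ∷ xs} (here refl) px with p y
... | true = tt
anyᵇ⁺ p {xs = y ∷ xs} (there x∈) px with p y
... | true  = tt
... | false = anyᵇ⁺ p x∈ px

T-not∨ : (b : Bool) {c : Bool} → T b → T (not b ∨ c) → T c
T-not∨ true _ t = t

countBy≡length∘filter : (p : List ℕ → Bool) (xss : List (List ℕ)) →
                        countBy p xss ≡ length (filter (T? ∘ p) xss)
countBy≡length∘filter p []         = refl
countBy≡length∘filter p (xs ∷ xss) with p xs
... | true  = cong suc (countBy≡length∘filter p xss)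
... | false = countBy≡length∘filter p xss

countBy-↭ : (p : List ℕ → Bool) {xss yss : List (List ℕ)} → xss ↭ yss → countBy p xss ≡ countBy p yss
countBy-↭ p {xss} {yss} xss↭yss = begin
  countBy p xss                    ≡⟨ countBy≡length∘filter p xss ⟩
  length (filter (T? ∘ p) xss)     ≡⟨ ↭-length (filter-↭ (T? ∘ p) xss↭yss) ⟩
  length (filter (T? ∘ p) yss)     ≡⟨ countBy≡length∘filter p yss ⟨
  countBy p yss                    ∎
  where open ≡-Reasoning

countBy-map : (p : List ℕ → Bool) (f : List ℕ → List ℕ) (xss : List (List ℕ)) →
              countBy p (map f xss) ≡ countBy (p ∘ f) xss
countBy-map p f []         = refl
countBy-map p f (xs ∷ xss) with p (f xs)
... | true  = cong suc (countBy-map p f xss)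
... | false = countBy-map p f xss

countBy-cong : {p q : List ℕ → Bool} (xss : List (List ℕ)) → (∀ {xs} → xs ∈ xss → p xs ≡ q xs) →
               countBy p xss ≡ countBy q xss
countBy-cong {p} {q} []         p≗q = refl
countBy-cong {p} {q} (xs ∷ xss) p≗q with p xs | q xs | p≗q (here refl)
... | true  | true  | _ = cong suc (countBy-cong xss (p≗q ∘ there))
... | false | false | _ = countBy-cong xss (p≗q ∘ there)

countBy-∧-not+∧ : (p q : List ℕ → Bool) (xss : List (List ℕ)) →
                  countBy p xss ≡ countBy (λ xs → p xs ∧ not (q xs)) xss + countBy (λ xs → p xs ∧ q xs) xss
countBy-∧-not+∧ p q []         = refl
countBy-∧-not+∧ p q (xs ∷ xss) with p xs | q xs
... | true  | true  = trans (cong suc (countBy-∧-not+∧ p q xss)) (sym (+-suc _ _))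
... | true  | false = cong suc (countBy-∧-not+∧ p q xss)
... | false | _     = countBy-∧-not+∧ p q xss

countBy-≡0 : (q : List ℕ → Bool) (xss : List (List ℕ)) → (∀ {xs} → xs ∈ xss → q xs ≡ false) →
             countBy q xss ≡ 0
countBy-≡0 q []         none = refl
countBy-≡0 q (xs ∷ xss) none rewrite none (here refl) = countBy-≡0 q xss (none ∘ there)

countBy-≡1 : (q : List ℕ → Bool) {xss : List (List ℕ)} {ys : List ℕ} → Unique xss → ys ∈ xss → q ys ≡ true →
             (∀ {xs} → xs ∈ xss → q xs ≡ true → xs ≡ ys) → countBy q xss ≡ 1
countBy-≡1 q {xs ∷ xss} (xs∉xss ∷ _) (here refl) qxs only rewrite qxs =
  cong suc (countBy-≡0 q xss others)
  where
  others : ∀ {zs} → zs ∈ xss → q zs ≡ false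
  others {zs} zs∈ with q zs in qzs
  ... | true  = ⊥-elim (All.lookup xs∉xss zs∈ (sym (only (there zs∈) qzs)))
  ... | false = refl
countBy-≡1 q {xs ∷ xss} (xs∉xss ∷ uxss) (there ys∈) qys only with q xs in qxs
... | true  = ⊥-elim (All.lookup xs∉xss ys∈ (only (here refl) qxs))
... | false = countBy-≡1 q uxss ys∈ qys (only ∘ there)

-- Partitions and their enumeration

record IsPartition (λs : List ℕ) : Set where
  field
    positive : All (1 ≤_) λs
    sorted   : Linked _≥_ λs

open IsPartition

nonIncreasing⁻ : {xs : List ℕ} → T (nonIncreasing xs) → Linked _≥_ xs
nonIncreasing⁻ {[]}         _ = []
nonIncreasing⁻ {x ∷ []}     _ = [-]
nonIncreasing⁻ {x ∷ y ∷ xs} t =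
  let y≤x , sorted = to (T-∧ {y ≤ᵇ x}) t in ≤ᵇ⇒≤ y x y≤x ∷ nonIncreasing⁻ sorted

nonIncreasing⁺ : {xs : List ℕ} → Linked _≥_ xs → T (nonIncreasing xs)
nonIncreasing⁺ []             = tt
nonIncreasing⁺ [-]            = tt
nonIncreasing⁺ (y≤x ∷ sorted) = from T-∧ (≤⇒≤ᵇ y≤x , nonIncreasing⁺ sorted)

isPartitionOf⁻ : {n : ℕ} {λs : List ℕ} → T (isPartitionOf n λs) → IsPartition λs × sumℕ λs ≡ n
isPartitionOf⁻ {n} {λs} t
  with positive , t′ ← to (T-∧ {allPositive λs}) t
  with sorted , sum≡n ← to (T-∧ {nonIncreasing λs}) t′ =
  record { positive = All.map (≤ᵇ⇒≤ 1 _) (allᵇ⁻ _ positive) ; sorted = nonIncreasing⁻ sorted }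
  , ≡ᵇ⇒≡ (sumℕ λs) n sum≡n

isPartitionOf⁺ : {n : ℕ} {λs : List ℕ} → IsPartition λs → sumℕ λs ≡ n → T (isPartitionOf n λs)
isPartitionOf⁺ {n} {λs} p refl =
  from T-∧ (allᵇ⁺ _ (All.map ≤⇒≤ᵇ (positive p)) ,
            from T-∧ (nonIncreasing⁺ (sorted p) , ≡⇒≡ᵇ (sumℕ λs) n refl))

oneTo-unique : (m : ℕ) → Unique (oneTo m)
oneTo-unique m = Unique.map⁺ suc-injective (Unique.upTo⁺ m)

∈-oneTo⁺ : {x m : ℕ} → 1 ≤ x → x ≤ m → x ∈ oneTo m
∈-oneTo⁺ {suc x} _ x<m = ∈-map⁺ suc (∈-upTo⁺ x<m)

∈-oneTo⁻ : {x m : ℕ} → x ∈ oneTo m → 1 ≤ x × x ≤ m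
∈-oneTo⁻ x∈ with _ , x′∈ , refl ← ∈-map⁻ suc x∈ = s≤s z≤n , ∈-upTo⁻ x′∈

listsUpTo-suc : (k m : ℕ) → listsUpTo (suc k) m ≡ [] ∷ cartesianProductWith _∷_ (oneTo m) (listsUpTo k m)
listsUpTo-suc k m = cong ([] ∷_) (concatMap≡cartesianProductWith _∷_ (oneTo m) (listsUpTo k m))

listsUpTo-unique : (k m : ℕ) → Unique (listsUpTo k m)
listsUpTo-unique zero    m = [] ∷ []
listsUpTo-unique (suc k) m rewrite listsUpTo-suc k m =
  All.tabulate []∉ ∷ Unique.cartesianProductWith⁺ _∷_ ∷-injective (oneTo-unique m) (listsUpTo-unique k m)
  where
  []∉ : ∀ {xs} → xs ∈ cartesianProductWith _∷_ (oneTo m) (listsUpTo k m) → [] ≢ xs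
  []∉ xs∈ with _ , _ , _ , _ , refl ← ∈-cartesianProductWith⁻ _∷_ (oneTo m) (listsUpTo k m) xs∈ = λ ()

∈-listsUpTo⁺ : (k m : ℕ) {xs : List ℕ} → length xs ≤ k → All (_∈ oneTo m) xs → xs ∈ listsUpTo k m
∈-listsUpTo⁺ zero    m {[]}     _         _            = here refl
∈-listsUpTo⁺ (suc k) m {[]}     _         _            = here refl
∈-listsUpTo⁺ (suc k) m {x ∷ xs} (s≤s len) (x∈ ∷ xs∈) rewrite listsUpTo-suc k m =
  there (∈-cartesianProductWith⁺ _∷_ x∈ (∈-listsUpTo⁺ k m len xs∈))

length≤sum : {xs : List ℕ} → All (1 ≤_) xs → length xs ≤ sumℕ xs
length≤sum []         = z≤n
length≤sum (1≤x ∷ ps) = +-mono-≤ 1≤x (length≤sum ps)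

part≤sum : (xs : List ℕ) → All (_≤ sumℕ xs) xs
part≤sum []       = []
part≤sum (x ∷ xs) = m≤m+n x (sumℕ xs) ∷ All.map (λ y≤ → ≤-trans y≤ (m≤n+m (sumℕ xs) x)) (part≤sum xs)

partitions-unique : (n : ℕ) → Unique (partitions n)
partitions-unique n rewrite filterᵇ≡filter (isPartitionOf n) (listsUpTo n n) =
  Unique.filter⁺ _ (listsUpTo-unique n n)

∈-partitions⁻ : (n : ℕ) {λs : List ℕ} → λs ∈ partitions n → IsPartition λs × sumℕ λs ≡ n
∈-partitions⁻ n λs∈ rewrite filterᵇ≡filter (isPartitionOf n) (listsUpTo n n) =
  isPartitionOf⁻ (proj₂ (∈-filter⁻ (T? ∘ isPartitionOf n) {xs = listsUpTo n n} λs∈))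

∈-partitions⁺ : (n : ℕ) {λs : List ℕ} → IsPartition λs → sumℕ λs ≡ n → λs ∈ partitions n
∈-partitions⁺ n {λs} p refl rewrite filterᵇ≡filter (isPartitionOf n) (listsUpTo n n) =
  ∈-filter⁺ _ (∈-listsUpTo⁺ n n (length≤sum (positive p)) parts∈) (isPartitionOf⁺ {sumℕ λs} p refl)
  where
  parts∈ : All (_∈ oneTo (sumℕ λs)) λs
  parts∈ = All.zipWith (λ (1≤x , x≤n) → ∈-oneTo⁺ 1≤x x≤n) (positive p , part≤sum λs)

≡ᵇ-reflects-≡ : (m n : ℕ) → Reflects (m ≡ n) (m ≡ᵇ n)
≡ᵇ-reflects-≡ m n = proof (m ≟ n)

occ-≡ : (x : ℕ) (xs : List ℕ) → occ x (x ∷ xs) ≡ suc (occ x xs)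
occ-≡ x xs with x ≡ᵇ x | ≡ᵇ-reflects-≡ x x
... | true  | _       = refl
... | false | ofⁿ x≢x = contradiction refl x≢x

occ-≢ : {j x : ℕ} (xs : List ℕ) → j ≢ x → occ j (x ∷ xs) ≡ occ j xs
occ-≢ {j} {x} xs j≢x with j ≡ᵇ x | ≡ᵇ-reflects-≡ j x
... | true  | ofʸ j≡x = contradiction j≡x j≢x
... | false | _       = refl

occ-≤-∷ : (j x : ℕ) (xs : List ℕ) → occ j xs ≤ occ j (x ∷ xs)
occ-≤-∷ j x xs with j ≡ᵇ x
... | true  = n≤1+n _
... | false = ≤-refl

occ>0⇒∈ : {j : ℕ} (xs : List ℕ) → 1 ≤ occ j xs → j ∈ xs
occ>0⇒∈ {j} (x ∷ xs) 1≤occ with j ≡ᵇ x | ≡ᵇ-reflects-≡ j x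
... | true  | ofʸ j≡x = here j≡x
... | false | _       = there (occ>0⇒∈ xs 1≤occ)

∈⇒occ>0 : {j : ℕ} {xs : List ℕ} → j ∈ xs → 1 ≤ occ j xs
∈⇒occ>0 {j} {x ∷ xs} (here refl) rewrite occ-≡ j xs = s≤s z≤n
∈⇒occ>0 {j} {x ∷ xs} (there j∈) = ≤-trans (∈⇒occ>0 j∈) (occ-≤-∷ j x xs)

repeated⇒∈ : {j : ℕ} (xs : List ℕ) → 2 ≤ occ j xs → j ∈ xs
repeated⇒∈ xs 2≤occ = occ>0⇒∈ xs (≤-trans (s≤s z≤n) 2≤occ)

occ-∉ : {j : ℕ} (xs : List ℕ) → j ∉ xs → occ j xs ≡ 0
occ-∉ []       _   = refl
occ-∉ (x ∷ xs) j∉ rewrite occ-≢ xs (j∉ ∘ here) = occ-∉ xs (j∉ ∘ there)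

occ-++ : (j : ℕ) (xs ys : List ℕ) → occ j (xs ++ ys) ≡ occ j xs + occ j ys
occ-++ j []       ys = refl
occ-++ j (x ∷ xs) ys with j ≡ᵇ x
... | true  = cong suc (occ-++ j xs ys)
... | false = occ-++ j xs ys

occ-map-suc : (j : ℕ) (xs : List ℕ) → occ (suc j) (map suc xs) ≡ occ j xs
occ-map-suc j []       = refl
occ-map-suc j (x ∷ xs) rewrite occ-map-suc j xs = refl

occ-replicate-≡ : (c x : ℕ) → occ x (replicate c x) ≡ c
occ-replicate-≡ zero    x = refl
occ-replicate-≡ (suc c) x = trans (occ-≡ x (replicate c x)) (cong suc (occ-replicate-≡ c x))

occ-replicate-≢ : {j x : ℕ} (c : ℕ) → j ≢ x → occ j (replicate c x) ≡ 0
occ-replicate-≢ zero    j≢x = refl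
occ-replicate-≢ (suc c) j≢x = trans (occ-≢ (replicate c _) j≢x) (occ-replicate-≢ c j≢x)

-- Initial 2-repetitions

-- λs has initial 2-repetitions and its largest repeated part is k (k = 0: no part is repeated).
record RepeatsUpTo (k : ℕ) (λs : List ℕ) : Set where
  field
    repeated≤k : ∀ {j} → 1 ≤ j → j ≤ k → 2 ≤ occ j λs
    single>k   : ∀ {j} → k < j → occ j λs ≤ 1

open RepeatsUpTo

repeatsUpTo-unique : {k k′ : ℕ} {λs : List ℕ} → RepeatsUpTo k λs → RepeatsUpTo k′ λs → k ≡ k′
repeatsUpTo-unique {k} {k′} r r′ with <-cmp k k′
... | tri≈ _ k≡k′ _ = k≡k′
... | tri< k<k′ _ _ = contradiction (repeated≤k r′ (≤-<-trans z≤n k<k′) ≤-refl) (<⇒≱ (s≤s (single>k r k<k′)))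
... | tri> _ _ k′<k = contradiction (repeated≤k r (≤-<-trans z≤n k′<k) ≤-refl) (<⇒≱ (s≤s (single>k r′ k′<k)))

repeatsUpTo⇒≤length : {k : ℕ} {λs : List ℕ} → RepeatsUpTo k λs → k ≤ length λs
repeatsUpTo⇒≤length {k} {λs} r =
  ≤-trans (≤-reflexive (sym length-oneTo)) (unique⊆⇒length≤ (oneTo-unique k) oneTo⊆λs)
  where
  length-oneTo : length (oneTo k) ≡ k
  length-oneTo = trans (length-map suc (upTo k)) (length-upTo k)
  oneTo⊆λs : oneTo k ⊆ λs
  oneTo⊆λs j∈ with 1≤j , j≤k ← ∈-oneTo⁻ j∈ = repeated⇒∈ λs (repeated≤k r 1≤j j≤k)

-- maxRep λs is by definition maxWhere (repeated λs) λs; abstracting the predicate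
-- lets the lemmas below recurse on the list while keeping repeated λs fixed.
maxWhere : (ℕ → Bool) → List ℕ → ℕ
maxWhere p = foldr (λ x m → if p x ∧ (m ≤ᵇ x) then x else m) 0

maxWhere-≤-∷ : (p : ℕ → Bool) (y : ℕ) (xs : List ℕ) → maxWhere p xs ≤ maxWhere p (y ∷ xs)
maxWhere-≤-∷ p y xs with p y | maxWhere p xs ≤ᵇ y | ≤ᵇ-reflects-≤ (maxWhere p xs) y
... | true  | true  | ofʸ m≤y = m≤y
... | true  | false | _       = ≤-refl
... | false | _     | _       = ≤-refl

≤-maxWhere : (p : ℕ → Bool) {x : ℕ} {xs : List ℕ} → x ∈ xs → T (p x) → x ≤ maxWhere p xs
≤-maxWhere p {x} {_ ∷ xs} (here refl) px
  with p x | maxWhere p xs ≤ᵇ x | ≤ᵇ-reflects-≤ (maxWhere p xs) x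
... | true  | true  | _       = ≤-refl
... | true  | false | ofⁿ m≰x = <⇒≤ (≰⇒> m≰x)
... | false | _     | _       = ⊥-elim px
≤-maxWhere p {xs = y ∷ xs} (there x∈) px = ≤-trans (≤-maxWhere p x∈ px) (maxWhere-≤-∷ p y xs)

maxWhere-satisfies : (p : ℕ → Bool) (xs : List ℕ) →
                     maxWhere p xs ≡ 0 ⊎ (maxWhere p xs ∈ xs × T (p (maxWhere p xs)))
maxWhere-satisfies p [] = inj₁ refl
maxWhere-satisfies p (y ∷ xs) with p y in py | maxWhere p xs ≤ᵇ y
... | true  | true  = inj₂ (here refl , subst T (sym py) tt)
... | true  | false = map₂ (λ (m∈ , pm) → there m∈ , pm) (maxWhere-satisfies p xs)
... | false | _     = map₂ (λ (m∈ , pm) → there m∈ , pm) (maxWhere-satisfies p xs)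

repeated⁻ : (λs : List ℕ) (j : ℕ) → T (repeated λs j) → 2 ≤ occ j λs
repeated⁻ λs j = ≤ᵇ⇒≤ 2 (occ j λs)

repeated⁺ : (λs : List ℕ) (j : ℕ) → 2 ≤ occ j λs → T (repeated λs j)
repeated⁺ λs j = ≤⇒≤ᵇ

∈-oneTo-pred⁺ : {j k : ℕ} → 1 ≤ j → j < k → j ∈ oneTo (k ∸ 1)
∈-oneTo-pred⁺ 1≤j j<k = ∈-oneTo⁺ 1≤j (∸-monoˡ-≤ 1 j<k)

initial2Reps⇒repeatsUpTo : {λs : List ℕ} → T (initial2Reps λs) → RepeatsUpTo (maxRep λs) λs
initial2Reps⇒repeatsUpTo {λs} t = record { repeated≤k = twice ; single>k = once }
  where
  K = maxRep λs
  initial : All (λ j → T (not (repeated λs j) ∨ allᵇ (repeated λs) (oneTo (j ∸ 1)))) λs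
  initial = allᵇ⁻ _ t
  once : ∀ {j} → K < j → occ j λs ≤ 1
  once {j} K<j with 2 ≤? occ j λs
  ... | no  2≰occ = ≤-pred (≰⇒> 2≰occ)
  ... | yes 2≤occ =
    contradiction (≤-maxWhere (repeated λs) (repeated⇒∈ λs 2≤occ) (repeated⁺ λs j 2≤occ)) (<⇒≱ K<j)
  twice : ∀ {j} → 1 ≤ j → j ≤ K → 2 ≤ occ j λs
  twice {j} 1≤j j≤K with maxWhere-satisfies (repeated λs) λs
  ... | inj₁ K≡0 = contradiction (subst (j ≤_) K≡0 j≤K) (<⇒≱ 1≤j)
  ... | inj₂ (K∈ , repK) with j ≟ K
  ...   | yes refl = repeated⁻ λs K repK
  ...   | no  j≢K  = repeated⁻ λs j (All.lookup below-K (∈-oneTo-pred⁺ 1≤j (≤∧≢⇒< j≤K j≢K)))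
    where
    below-K : All (T ∘ repeated λs) (oneTo (K ∸ 1))
    below-K = allᵇ⁻ _ (T-not∨ (repeated λs K) repK (All.lookup initial K∈))

repeatsUpTo⇒initial2Reps : {k : ℕ} {λs : List ℕ} → RepeatsUpTo k λs → T (initial2Reps λs)
repeatsUpTo⇒initial2Reps {k} {λs} r = allᵇ⁺ _ (All.tabulate initial)
  where
  initial : ∀ {j} → j ∈ λs → T (not (repeated λs j) ∨ allᵇ (repeated λs) (oneTo (j ∸ 1)))
  initial {j} _ with repeated λs j | ≤ᵇ-reflects-≤ 2 (occ j λs)
  ... | false | _         = tt
  ... | true  | ofʸ 2≤occ = allᵇ⁺ _ (All.tabulate below)
    where
    j≤k : j ≤ k
    j≤k = ≮⇒≥ (λ k<j → <⇒≱ (s≤s (single>k r k<j)) 2≤occ)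
    below : ∀ {i} → i ∈ oneTo (j ∸ 1) → T (repeated λs i)
    below i∈ with 1≤i , i≤j∸1 ← ∈-oneTo⁻ i∈ =
      repeated⁺ λs _ (repeated≤k r 1≤i (≤-trans i≤j∸1 (≤-trans (m∸n≤m j 1) j≤k)))

repeatsUpTo-suc⇒hasRepeated : {k : ℕ} {λs : List ℕ} → RepeatsUpTo (suc k) λs → T (hasRepeated λs)
repeatsUpTo-suc⇒hasRepeated {k} {λs} r =
  anyᵇ⁺ (repeated λs) (repeated⇒∈ λs 2≤occ) (repeated⁺ λs (suc k) 2≤occ)
  where
  2≤occ : 2 ≤ occ (suc k) λs
  2≤occ = repeated≤k r (s≤s z≤n) ≤-refl

maxRep≡ : {k : ℕ} {λs : List ℕ} → RepeatsUpTo k λs → maxRep λs ≡ k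
maxRep≡ r = repeatsUpTo-unique (initial2Reps⇒repeatsUpTo (repeatsUpTo⇒initial2Reps r)) r

bE-cond≡even? : {k : ℕ} {λs : List ℕ} → RepeatsUpTo k λs → bE-cond λs ≡ even? k
bE-cond≡even? {zero} {λs} r
  rewrite to T-≡ (repeatsUpTo⇒initial2Reps r) | maxRep≡ r = ∨-zeroʳ (not (hasRepeated λs))
bE-cond≡even? {suc k} r
  rewrite to T-≡ (repeatsUpTo⇒initial2Reps r) | maxRep≡ r
        | to T-≡ (repeatsUpTo-suc⇒hasRepeated r) = refl

bO-cond≡odd? : {k : ℕ} {λs : List ℕ} → RepeatsUpTo k λs → bO-cond λs ≡ not (even? k)
bO-cond≡odd? {zero} {λs} r
  rewrite to T-≡ (repeatsUpTo⇒initial2Reps r) | maxRep≡ r = ∧-zeroʳ (hasRepeated λs)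
bO-cond≡odd? {suc k} r
  rewrite to T-≡ (repeatsUpTo⇒initial2Reps r) | maxRep≡ r
        | to T-≡ (repeatsUpTo-suc⇒hasRepeated r) = refl

-- Staircases

staircase : ℕ → List ℕ
staircase zero    = []
staircase (suc m) = suc m ∷ staircase m

isStaircase : List ℕ → Bool
isStaircase λs = does (≡-dec _≟_ λs (staircase (length λs)))

isStaircase⁻ : (λs : List ℕ) → isStaircase λs ≡ true → λs ≡ staircase (length λs)
isStaircase⁻ λs st with ≡-dec _≟_ λs (staircase (length λs))
... | yes λs≡ = λs≡

isStaircase⁺ : {λs : List ℕ} → λs ≡ staircase (length λs) → isStaircase λs ≡ true
isStaircase⁺ {λs} = dec-true (≡-dec _≟_ λs (staircase (length λs)))

length-staircase : (m : ℕ) → length (staircase m) ≡ m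
length-staircase zero    = refl
length-staircase (suc m) = cong suc (length-staircase m)

isStaircase-staircase : (m : ℕ) → isStaircase (staircase m) ≡ true
isStaircase-staircase m = isStaircase⁺ (cong staircase (sym (length-staircase m)))

-- On [] the junk value 0 is harmless: [] is a staircase and is never moved.
firstPart : List ℕ → ℕ
firstPart []      = 0
firstPart (x ∷ _) = x

firstPart-staircase : (m : ℕ) → firstPart (staircase m) ≡ m
firstPart-staircase zero    = refl
firstPart-staircase (suc m) = refl

staircase-decreasing : (m : ℕ) → Linked _>_ (staircase m)
staircase-decreasing zero          = []
staircase-decreasing (suc zero)    = [-]
staircase-decreasing (suc (suc m)) = ≤-refl ∷ staircase-decreasing (suc m)

staircase-positive : (m : ℕ) → All (1 ≤_) (staircase m)
staircase-positive zero    = []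
staircase-positive (suc m) = s≤s z≤n ∷ staircase-positive m

staircase-isPartition : (m : ℕ) → IsPartition (staircase m)
staircase-isPartition m = record
  { positive = staircase-positive m
  ; sorted   = Linked.map <⇒≤ (staircase-decreasing m)
  }

sum-staircase : (m : ℕ) → 2 * sumℕ (staircase m) ≡ m * (m + 1)
sum-staircase zero    = refl
sum-staircase (suc m) = begin
  2 * (suc m + sumℕ (staircase m))   ≡⟨ *-distribˡ-+ 2 (suc m) _ ⟩
  2 * suc m + 2 * sumℕ (staircase m) ≡⟨ cong (λ t → 2 * suc m + t) (sum-staircase m) ⟩
  2 * suc m + m * (m + 1)            ≡⟨ solve 1 (λ m → con 2 :* (con 1 :+ m) :+ m :* (m :+ con 1)
                                                     := (con 1 :+ m) :* ((con 1 :+ m) :+ con 1)) refl m ⟩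
  suc m * (suc m + 1)                ∎
  where
  open ≡-Reasoning
  open +-*-Solver

triangular-injective : {a b : ℕ} → a * (a + 1) ≡ b * (b + 1) → a ≡ b
triangular-injective {a} {b} eq with <-cmp a b
... | tri≈ _ a≡b _ = a≡b
... | tri< a<b _ _ = contradiction eq (<⇒≢ (*-mono-< a<b (+-monoˡ-< 1 a<b)))
... | tri> _ _ b<a = contradiction (sym eq) (<⇒≢ (*-mono-< b<a (+-monoˡ-< 1 b<a)))

decreasing⇒occ≤1 : {j : ℕ} {xs : List ℕ} → Linked _>_ xs → occ j xs ≤ 1
decreasing⇒occ≤1 {j} {[]}     _          = z≤n
decreasing⇒occ≤1 {j} {x ∷ xs} decreasing with j ≟ x
... | yes refl = ≤-reflexive (trans (occ-≡ j xs) (cong suc (occ-∉ xs j∉xs)))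
  where
  j∉xs : j ∉ xs
  j∉xs j∈xs = <-irrefl refl (All.lookup (Linked⇒All-tail (flip <-trans) decreasing) j∈xs)
... | no  j≢x  = ≤-trans (≤-reflexive (occ-≢ xs j≢x)) (decreasing⇒occ≤1 (Linked.tail decreasing))

staircase-repeatsUpTo-0 : (m : ℕ) → RepeatsUpTo 0 (staircase m)
staircase-repeatsUpTo-0 m = record
  { repeated≤k = λ 1≤j j≤0 → contradiction (≤-trans 1≤j j≤0) λ ()
  ; single>k   = λ _ → decreasing⇒occ≤1 (staircase-decreasing m)
  }

isStaircase⇒repeatsUpTo-0 : (λs : List ℕ) → isStaircase λs ≡ true → RepeatsUpTo 0 λs
isStaircase⇒repeatsUpTo-0 λs st =
  subst (RepeatsUpTo 0) (sym (isStaircase⁻ λs st)) (staircase-repeatsUpTo-0 (length λs))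

distinct⇒decreasing : {xs : List ℕ} → All (1 ≤_) xs → Linked _≥_ xs → (∀ {j} → 0 < j → occ j xs ≤ 1) →
                      Linked _>_ xs
distinct⇒decreasing _                            []             _      = []
distinct⇒decreasing _                            [-]            _      = [-]
distinct⇒decreasing {x ∷ y ∷ ys} (1≤x ∷ pos) (y≤x ∷ sorted) single =
  ≤∧≢⇒< y≤x y≢x ∷ distinct⇒decreasing pos sorted (λ 0<j → ≤-trans (occ-≤-∷ _ x (y ∷ ys)) (single 0<j))
  where
  y≢x : y ≢ x
  y≢x refl = <⇒≱ (≤-trans (s≤s (s≤s z≤n)) (≤-reflexive (sym twice))) (single 1≤x)
    where
    twice : occ y (y ∷ y ∷ ys) ≡ suc (suc (occ y ys))
    twice = trans (occ-≡ y (y ∷ ys)) (cong suc (occ-≡ y ys))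

decreasing⇒length≤head : {x : ℕ} {xs : List ℕ} → All (1 ≤_) (x ∷ xs) → Linked _>_ (x ∷ xs) →
                         length (x ∷ xs) ≤ x
decreasing⇒length≤head (1≤x ∷ _) [-]                = 1≤x
decreasing⇒length≤head (_ ∷ pos) (x>y ∷ decreasing) =
  ≤-trans (s≤s (decreasing⇒length≤head pos decreasing)) x>y

decreasing⇒≡staircase : {xs : List ℕ} → All (1 ≤_) xs → Linked _>_ xs → firstPart xs ≤ length xs →
                         xs ≡ staircase (length xs)
decreasing⇒≡staircase {[]}         _   _          _      = refl
decreasing⇒≡staircase {x ∷ []}     pos decreasing x≤len =
  cong (_∷ []) (≤-antisym x≤len (decreasing⇒length≤head pos decreasing))
decreasing⇒≡staircase {x ∷ y ∷ ys} pos decreasing x≤len =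
  cong₂ _∷_ x≡len (decreasing⇒≡staircase (All.tail pos) (Linked.tail decreasing) y≤len)
  where
  x≡len : x ≡ length (x ∷ y ∷ ys)
  x≡len = ≤-antisym x≤len (decreasing⇒length≤head pos decreasing)
  y≤len : y ≤ length (y ∷ ys)
  y≤len = ≤-pred (≤-trans (Linked.head decreasing) (≤-reflexive x≡len))

distinct⇒≡staircase : {λs : List ℕ} → IsPartition λs → RepeatsUpTo 0 λs → firstPart λs ≤ length λs →
                       λs ≡ staircase (length λs)
distinct⇒≡staircase p r =
  decreasing⇒≡staircase (positive p) (distinct⇒decreasing (positive p) (sorted p) (single>k r))

-- Trading the first column for the first row

-- Parts 0 never occur in a partition; that clause only makes the function total.
removeFirstColumn : List ℕ → List ℕ
removeFirstColumn []                 = []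
removeFirstColumn (zero ∷ xs)        = removeFirstColumn xs
removeFirstColumn (suc zero ∷ xs)    = removeFirstColumn xs
removeFirstColumn (suc (suc x) ∷ xs) = suc x ∷ removeFirstColumn xs

occ-removeFirstColumn : (j : ℕ) (xs : List ℕ) → occ (suc j) (removeFirstColumn xs) ≡ occ (suc (suc j)) xs
occ-removeFirstColumn j []                 = refl
occ-removeFirstColumn j (zero ∷ xs)        = occ-removeFirstColumn j xs
occ-removeFirstColumn j (suc zero ∷ xs)    = occ-removeFirstColumn j xs
occ-removeFirstColumn j (suc (suc x) ∷ xs) rewrite occ-removeFirstColumn j xs = refl

removeFirstColumn-positive : (xs : List ℕ) → All (1 ≤_) (removeFirstColumn xs)
removeFirstColumn-positive []                 = []
removeFirstColumn-positive (zero ∷ xs)        = removeFirstColumn-positive xs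
removeFirstColumn-positive (suc zero ∷ xs)    = removeFirstColumn-positive xs
removeFirstColumn-positive (suc (suc x) ∷ xs) = s≤s z≤n ∷ removeFirstColumn-positive xs

removeFirstColumn-sorted : {b : ℕ} {xs : List ℕ} → Linked _≥_ xs → All (_≤ suc b) xs →
                           Linked _≥_ (b ∷ removeFirstColumn xs)
removeFirstColumn-sorted {xs = []}               _      _             = [-]
removeFirstColumn-sorted {xs = zero ∷ xs}        sorted (_ ∷ xs≤)     = removeFirstColumn-sorted (Linked.tail sorted) xs≤
removeFirstColumn-sorted {xs = suc zero ∷ xs}    sorted (_ ∷ xs≤)     = removeFirstColumn-sorted (Linked.tail sorted) xs≤
removeFirstColumn-sorted {xs = suc (suc x) ∷ xs} sorted (s≤s x<b ∷ _) =
  x<b ∷ removeFirstColumn-sorted (Linked.tail sorted) (Linked⇒All-tail (flip ≤-trans) sorted)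

length+sum-removeFirstColumn : {xs : List ℕ} → All (1 ≤_) xs →
                               length xs + sumℕ (removeFirstColumn xs) ≡ sumℕ xs
length+sum-removeFirstColumn []                           = refl
length+sum-removeFirstColumn {suc zero ∷ xs}    (_ ∷ pos) = cong suc (length+sum-removeFirstColumn pos)
length+sum-removeFirstColumn {suc (suc x) ∷ xs} (_ ∷ pos) = cong suc (begin
  length xs + (suc x + sumℕ (removeFirstColumn xs))
    ≡⟨ x∙yz≈y∙xz (length xs) (suc x) _ ⟩
  suc x + (length xs + sumℕ (removeFirstColumn xs))
    ≡⟨ cong (λ t → suc x + t) (length+sum-removeFirstColumn pos) ⟩
  suc x + sumℕ xs ∎)
  where open ≡-Reasoning

length-removeFirstColumn : (xs : List ℕ) → length (removeFirstColumn xs) + occ 1 xs ≤ length xs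
length-removeFirstColumn []                 = z≤n
length-removeFirstColumn (zero ∷ xs)        = m≤n⇒m≤1+n (length-removeFirstColumn xs)
length-removeFirstColumn (suc zero ∷ xs)    =
  ≤-trans (≤-reflexive (+-suc (length (removeFirstColumn xs)) (occ 1 xs))) (s≤s (length-removeFirstColumn xs))
length-removeFirstColumn (suc (suc x) ∷ xs) = s≤s (length-removeFirstColumn xs)

removeFirstColumn-map-suc : {xs : List ℕ} → All (1 ≤_) xs → removeFirstColumn (map suc xs) ≡ xs
removeFirstColumn-map-suc []                     = refl
removeFirstColumn-map-suc {suc x ∷ xs} (_ ∷ pos) = cong (suc x ∷_) (removeFirstColumn-map-suc pos)

removeFirstColumn-replicate-1 : (c : ℕ) → removeFirstColumn (replicate c 1) ≡ []
removeFirstColumn-replicate-1 zero    = refl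
removeFirstColumn-replicate-1 (suc c) = removeFirstColumn-replicate-1 c

removeFirstColumn-++ : (xs ys : List ℕ) →
                       removeFirstColumn (xs ++ ys) ≡ removeFirstColumn xs ++ removeFirstColumn ys
removeFirstColumn-++ []                 ys = refl
removeFirstColumn-++ (zero ∷ xs)        ys = removeFirstColumn-++ xs ys
removeFirstColumn-++ (suc zero ∷ xs)    ys = removeFirstColumn-++ xs ys
removeFirstColumn-++ (suc (suc x) ∷ xs) ys = cong (suc x ∷_) (removeFirstColumn-++ xs ys)

≡replicate-1 : {xs : List ℕ} → All (1 ≤_) xs → All (_≤ 1) xs → xs ≡ replicate (length xs) 1
≡replicate-1 []          []           = refl
≡replicate-1 (1≤x ∷ pos) (x≤1 ∷ xs≤1) = cong₂ _∷_ (≤-antisym x≤1 1≤x) (≡replicate-1 pos xs≤1)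

columnToRow : List ℕ → List ℕ
columnToRow λs = length λs ∷ removeFirstColumn λs

-- The subtraction is truncated: this moves the first row r into a new first column
-- only when length μ ≤ r.
rowToColumn : List ℕ → List ℕ
rowToColumn []      = []
rowToColumn (r ∷ μ) = map suc μ ++ replicate (r ∸ length μ) 1

rowToColumn-columnToRow : {xs : List ℕ} → IsPartition xs → rowToColumn (columnToRow xs) ≡ xs
rowToColumn-columnToRow {[]} _ = refl
rowToColumn-columnToRow {zero ∷ xs} p = contradiction (All.head (positive p)) λ ()
rowToColumn-columnToRow {suc zero ∷ xs} p = begin
  rowToColumn (columnToRow (1 ∷ xs))
    ≡⟨ cong (λ ys → rowToColumn (suc (length xs) ∷ ys)) removeFirstColumn-xs ⟩
  1 ∷ replicate (length xs) 1
    ≡⟨ cong (1 ∷_) xs≡ones ⟨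
  1 ∷ xs ∎
  where
  open ≡-Reasoning
  xs≡ones : xs ≡ replicate (length xs) 1
  xs≡ones = ≡replicate-1 (All.tail (positive p)) (Linked⇒All-tail (flip ≤-trans) (sorted p))
  removeFirstColumn-xs : removeFirstColumn xs ≡ []
  removeFirstColumn-xs = trans (cong removeFirstColumn xs≡ones) (removeFirstColumn-replicate-1 (length xs))
rowToColumn-columnToRow {suc (suc x) ∷ xs} p =
  cong (suc (suc x) ∷_) (rowToColumn-columnToRow tail-partition)
  where
  tail-partition : IsPartition xs
  tail-partition = record { positive = All.tail (positive p) ; sorted = Linked.tail (sorted p) }

length-rowToColumn : {r : ℕ} {μ : List ℕ} → length μ ≤ r → length (rowToColumn (r ∷ μ)) ≡ r
length-rowToColumn {r} {μ} μ≤r = begin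
  length (map suc μ ++ replicate (r ∸ length μ) 1)
    ≡⟨ length-++ (map suc μ) ⟩
  length (map suc μ) + length (replicate (r ∸ length μ) 1)
    ≡⟨ cong₂ _+_ (length-map suc μ) (length-replicate (r ∸ length μ)) ⟩
  length μ + (r ∸ length μ)
    ≡⟨ m+[n∸m]≡n μ≤r ⟩
  r ∎
  where open ≡-Reasoning

sum-columnToRow : {λs : List ℕ} → All (1 ≤_) λs → sumℕ (columnToRow λs) ≡ sumℕ λs
sum-columnToRow = length+sum-removeFirstColumn

sum-map-suc : (xs : List ℕ) → sumℕ (map suc xs) ≡ length xs + sumℕ xs
sum-map-suc []       = refl
sum-map-suc (x ∷ xs) =
  cong suc (trans (cong (λ t → x + t) (sum-map-suc xs)) (x∙yz≈y∙xz x (length xs) (sumℕ xs)))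

sum-replicate-1 : (c : ℕ) → sumℕ (replicate c 1) ≡ c
sum-replicate-1 zero    = refl
sum-replicate-1 (suc c) = cong suc (sum-replicate-1 c)

replicate-sorted : (c x : ℕ) → Linked _≥_ (replicate c x)
replicate-sorted zero          x = []
replicate-sorted (suc zero)    x = [-]
replicate-sorted (suc (suc c)) x = ≤-refl ∷ replicate-sorted (suc c) x

addColumn-sorted : {c : ℕ} {μ : List ℕ} → Linked _≥_ μ → 1 ≤ c → Linked _≥_ (map suc μ ++ replicate c 1)
addColumn-sorted {c}     {[]}         _              _   = replicate-sorted c 1
addColumn-sorted {suc c} {y ∷ []}     _              _   = s≤s z≤n ∷ replicate-sorted (suc c) 1
addColumn-sorted {μ = y ∷ z ∷ ν}      (z≤y ∷ sorted) 1≤c = s≤s z≤y ∷ addColumn-sorted sorted 1≤c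

firstPart-rowToColumn : {r : ℕ} {μ : List ℕ} → Linked _≥_ (r ∷ μ) → r ∉ μ → 1 ≤ r →
                        firstPart (rowToColumn (r ∷ μ)) ≤ r
firstPart-rowToColumn {suc r} {[]}    _         _   _ = s≤s z≤n
firstPart-rowToColumn {r}     {y ∷ μ} (y≤r ∷ _) r∉μ _ = ≤∧≢⇒< y≤r (λ y≡r → r∉μ (here (sym y≡r)))

occ-1-rowToColumn : {r : ℕ} {μ : List ℕ} → All (1 ≤_) μ → occ 1 (rowToColumn (r ∷ μ)) ≡ r ∸ length μ
occ-1-rowToColumn {r} {μ} pos = begin
  occ 1 (map suc μ ++ replicate (r ∸ length μ) 1)
    ≡⟨ occ-++ 1 (map suc μ) _ ⟩
  occ 1 (map suc μ) + occ 1 (replicate (r ∸ length μ) 1)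
    ≡⟨ cong₂ _+_ (occ-map-suc 0 μ) (occ-replicate-≡ (r ∸ length μ) 1) ⟩
  occ 0 μ + (r ∸ length μ)
    ≡⟨ cong (λ t → t + (r ∸ length μ)) (occ-∉ μ (λ 0∈μ → 1+n≰n (All.lookup pos 0∈μ))) ⟩
  r ∸ length μ ∎
  where open ≡-Reasoning

occ-2+-rowToColumn : (i r : ℕ) (μ : List ℕ) → occ (suc (suc i)) (rowToColumn (r ∷ μ)) ≡ occ (suc i) μ
occ-2+-rowToColumn i r μ = begin
  occ (suc (suc i)) (map suc μ ++ replicate (r ∸ length μ) 1)
    ≡⟨ occ-++ (suc (suc i)) (map suc μ) _ ⟩
  occ (suc (suc i)) (map suc μ) + occ (suc (suc i)) (replicate (r ∸ length μ) 1)
    ≡⟨ cong₂ _+_ (occ-map-suc (suc i) μ) (occ-replicate-≢ (r ∸ length μ) λ ()) ⟩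
  occ (suc i) μ + 0
    ≡⟨ +-identityʳ _ ⟩
  occ (suc i) μ ∎
  where open ≡-Reasoning

-- columnToRow and rowToColumn are inverse bijections between ColumnShaped k and
-- RowShaped k; the largest repeated part drops from k + 1 to k.
record ColumnShaped (k : ℕ) (λs : List ℕ) : Set where
  constructor columnShaped
  field
    isPartition : IsPartition λs
    repeats     : RepeatsUpTo (suc k) λs
    head≤length : firstPart λs ≤ length λs

record RowShaped (k : ℕ) (λs : List ℕ) : Set where
  constructor rowShaped
  field
    isPartition : IsPartition λs
    repeats     : RepeatsUpTo k λs
    length<head : length λs < firstPart λs

rowShaped⇒length-tail≤head : {k r : ℕ} {μ : List ℕ} → RowShaped k (r ∷ μ) → length μ ≤ r
rowShaped⇒length-tail≤head (rowShaped _ _ len<r) = ≤-trans (n≤1+n _) (<⇒≤ len<r)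

columnToRow-rowToColumn : {k : ℕ} {λs : List ℕ} → RowShaped k λs → columnToRow (rowToColumn λs) ≡ λs
columnToRow-rowToColumn {k} {r ∷ μ} rs@(rowShaped p _ _) =
  cong₂ _∷_ (length-rowToColumn {r} {μ} (rowShaped⇒length-tail≤head rs)) (begin
    removeFirstColumn (map suc μ ++ replicate c 1)
      ≡⟨ removeFirstColumn-++ (map suc μ) _ ⟩
    removeFirstColumn (map suc μ) ++ removeFirstColumn (replicate c 1)
      ≡⟨ cong₂ _++_ (removeFirstColumn-map-suc (All.tail (positive p))) (removeFirstColumn-replicate-1 c) ⟩
    μ ++ []
      ≡⟨ ++-identityʳ μ ⟩
    μ ∎)
  where
  open ≡-Reasoning
  c = r ∸ length μ

sum-rowToColumn : {k : ℕ} {λs : List ℕ} → RowShaped k λs → sumℕ (rowToColumn λs) ≡ sumℕ λs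
sum-rowToColumn {k} {r ∷ μ} rs = begin
  sumℕ (map suc μ ++ replicate c 1)        ≡⟨ sum-++ (map suc μ) _ ⟩
  sumℕ (map suc μ) + sumℕ (replicate c 1) ≡⟨ cong₂ _+_ (sum-map-suc μ) (sum-replicate-1 c) ⟩
  length μ + sumℕ μ + c                   ≡⟨ xy∙z≈xz∙y (length μ) (sumℕ μ) c ⟩
  length μ + c + sumℕ μ                   ≡⟨ cong (λ t → t + sumℕ μ) (m+[n∸m]≡n (rowShaped⇒length-tail≤head rs)) ⟩
  r + sumℕ μ                              ∎
  where
  open ≡-Reasoning
  c = r ∸ length μ

columnToRow-rowShaped : {k : ℕ} {λs : List ℕ} → ColumnShaped k λs → RowShaped k (columnToRow λs)
columnToRow-rowShaped {k} {[]}     (columnShaped _ r _)   = contradiction (repeated≤k r ≤-refl (s≤s z≤n)) λ ()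
columnToRow-rowShaped {k} {x ∷ xs} (columnShaped p r x≤ℓ) = rowShaped partition repeats shorter
  where
  open ≤-Reasoning
  ℓ = length (x ∷ xs)
  ρ = removeFirstColumn (x ∷ xs)
  parts≤ℓ : All (_≤ ℓ) (x ∷ xs)
  parts≤ℓ = All.map (λ y≤x → ≤-trans y≤x x≤ℓ) (≤-refl ∷ Linked⇒All-tail (flip ≤-trans) (sorted p))
  partition : IsPartition (ℓ ∷ ρ)
  partition = record
    { positive = s≤s z≤n ∷ removeFirstColumn-positive (x ∷ xs)
    ; sorted   = removeFirstColumn-sorted (sorted p) (All.map m≤n⇒m≤1+n parts≤ℓ)
    }
  ℓ-once : occ ℓ (ℓ ∷ ρ) ≡ 1
  ℓ-once = begin-equality
    occ ℓ (ℓ ∷ ρ)              ≡⟨ occ-≡ ℓ ρ ⟩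
    suc (occ ℓ ρ)              ≡⟨ cong suc (occ-removeFirstColumn (length xs) (x ∷ xs)) ⟩
    suc (occ (suc ℓ) (x ∷ xs)) ≡⟨ cong suc (occ-∉ (x ∷ xs) (λ 1+ℓ∈ → 1+n≰n (All.lookup parts≤ℓ 1+ℓ∈))) ⟩
    1                          ∎
  twice : ∀ {j} → 1 ≤ j → j ≤ k → 2 ≤ occ j (ℓ ∷ ρ)
  twice {suc j} _ j<k = begin
    2                          ≤⟨ repeated≤k r (s≤s z≤n) (s≤s j<k) ⟩
    occ (suc (suc j)) (x ∷ xs) ≡⟨ occ-removeFirstColumn j (x ∷ xs) ⟨
    occ (suc j) ρ              ≤⟨ occ-≤-∷ (suc j) ℓ ρ ⟩
    occ (suc j) (ℓ ∷ ρ)        ∎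
  once : ∀ {j} → k < j → occ j (ℓ ∷ ρ) ≤ 1
  once {suc j} k<j with suc j ≟ ℓ
  ... | yes refl = ≤-reflexive ℓ-once
  ... | no  j≢ℓ  = begin
    occ (suc j) (ℓ ∷ ρ)        ≡⟨ occ-≢ ρ j≢ℓ ⟩
    occ (suc j) ρ              ≡⟨ occ-removeFirstColumn j (x ∷ xs) ⟩
    occ (suc (suc j)) (x ∷ xs) ≤⟨ single>k r (s≤s k<j) ⟩
    1                          ∎
  repeats : RepeatsUpTo k (ℓ ∷ ρ)
  repeats = record { repeated≤k = twice ; single>k = once }
  shorter : length (ℓ ∷ ρ) < ℓ
  shorter = begin-strict
    suc (length ρ)            <⟨ ≤-refl ⟩
    2 + length ρ              ≡⟨ +-comm 2 (length ρ) ⟩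
    length ρ + 2              ≤⟨ +-monoʳ-≤ (length ρ) (repeated≤k r (s≤s z≤n) (s≤s z≤n)) ⟩
    length ρ + occ 1 (x ∷ xs) ≤⟨ length-removeFirstColumn (x ∷ xs) ⟩
    ℓ                         ∎

rowToColumn-columnShaped : {k : ℕ} {λs : List ℕ} → RowShaped k λs → ColumnShaped k (rowToColumn λs)
rowToColumn-columnShaped {k} {r ∷ μ} rs@(rowShaped p rep len<r) = columnShaped partition repeats head≤length
  where
  open ≤-Reasoning
  c = r ∸ length μ
  2≤c : 2 ≤ c
  2≤c = m+n≤o⇒m≤o∸n 2 len<r
  k<r : k < r
  k<r = ≤-<-trans (repeatsUpTo⇒≤length rep) len<r
  r∉μ : r ∉ μ
  r∉μ r∈μ = <⇒≱ (s≤s (∈⇒occ>0 r∈μ)) (≤-trans (≤-reflexive (sym (occ-≡ r μ))) (single>k rep k<r))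
  partition : IsPartition (rowToColumn (r ∷ μ))
  partition = record
    { positive = All.++⁺ (All.map⁺ (All.universal (λ _ → s≤s z≤n) μ)) (All.replicate⁺ c (s≤s z≤n))
    ; sorted   = addColumn-sorted (Linked.tail (sorted p)) (≤-trans (s≤s z≤n) 2≤c)
    }
  twice : ∀ {j} → 1 ≤ j → j ≤ suc k → 2 ≤ occ j (rowToColumn (r ∷ μ))
  twice {suc zero}    _ _         = ≤-trans 2≤c (≤-reflexive (sym (occ-1-rowToColumn (All.tail (positive p)))))
  twice {suc (suc i)} _ (s≤s i<k) = begin
    2                                       ≤⟨ repeated≤k rep (s≤s z≤n) i<k ⟩
    occ (suc i) (r ∷ μ)                     ≡⟨ occ-≢ μ (<⇒≢ (≤-<-trans i<k k<r)) ⟩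
    occ (suc i) μ                           ≡⟨ occ-2+-rowToColumn i r μ ⟨
    occ (suc (suc i)) (rowToColumn (r ∷ μ)) ∎
  once : ∀ {j} → suc k < j → occ j (rowToColumn (r ∷ μ)) ≤ 1
  once {suc (suc i)} (s≤s k<1+i) = begin
    occ (suc (suc i)) (rowToColumn (r ∷ μ)) ≡⟨ occ-2+-rowToColumn i r μ ⟩
    occ (suc i) μ                           ≤⟨ occ-≤-∷ (suc i) r μ ⟩
    occ (suc i) (r ∷ μ)                     ≤⟨ single>k rep k<1+i ⟩
    1                                       ∎
  repeats : RepeatsUpTo (suc k) (rowToColumn (r ∷ μ))
  repeats = record { repeated≤k = twice ; single>k = once }
  head≤length : firstPart (rowToColumn (r ∷ μ)) ≤ length (rowToColumn (r ∷ μ))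
  head≤length = begin
    firstPart (rowToColumn (r ∷ μ)) ≤⟨ firstPart-rowToColumn (sorted p) r∉μ (≤-trans (s≤s z≤n) len<r) ⟩
    r                               ≡⟨ length-rowToColumn {r} {μ} (rowShaped⇒length-tail≤head rs) ⟨
    length (rowToColumn (r ∷ μ))    ∎

columnShaped-¬staircase : {k : ℕ} {λs : List ℕ} → ColumnShaped k λs → isStaircase λs ≡ false
columnShaped-¬staircase {k} {λs} (columnShaped _ r _) with isStaircase λs in st
... | true  = contradiction (repeatsUpTo-unique r (isStaircase⇒repeatsUpTo-0 λs st)) λ ()
... | false = refl

rowShaped-¬staircase : {k : ℕ} {λs : List ℕ} → RowShaped k λs → isStaircase λs ≡ false
rowShaped-¬staircase {k} {λs} (rowShaped _ _ len<head) with isStaircase λs in st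
... | true  = contradiction head≡len (<⇒≢ len<head ∘′ sym)
  where
  head≡len : firstPart λs ≡ length λs
  head≡len = trans (cong firstPart (isStaircase⁻ λs st)) (firstPart-staircase (length λs))
... | false = refl

-- The involution

moves : List ℕ → Bool
moves λs = initial2Reps λs ∧ not (isStaircase λs)

exchange : List ℕ → List ℕ
exchange λs =
  if moves λs
  then (if firstPart λs ≤ᵇ length λs then columnToRow λs else rowToColumn λs)
  else λs

repeatsUpTo⇒moves : {k : ℕ} {λs : List ℕ} → RepeatsUpTo k λs → isStaircase λs ≡ false → moves λs ≡ true
repeatsUpTo⇒moves r st = cong₂ (λ a b → a ∧ not b) (to T-≡ (repeatsUpTo⇒initial2Reps r)) st

exchange-columnShaped : {k : ℕ} {λs : List ℕ} → ColumnShaped k λs → exchange λs ≡ columnToRow λs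
exchange-columnShaped {k} {λs} c@(columnShaped _ r head≤length)
  rewrite repeatsUpTo⇒moves r (columnShaped-¬staircase c) | to T-≡ (≤⇒≤ᵇ head≤length) = refl

exchange-rowShaped : {k : ℕ} {λs : List ℕ} → RowShaped k λs → exchange λs ≡ rowToColumn λs
exchange-rowShaped {k} {λs} rs@(rowShaped _ r len<head)
  rewrite repeatsUpTo⇒moves r (rowShaped-¬staircase rs)
  with firstPart λs ≤ᵇ length λs | ≤ᵇ-reflects-≤ (firstPart λs) (length λs)
... | true  | ofʸ head≤len = contradiction head≤len (<⇒≱ len<head)
... | false | _            = refl

exchange-fixed : {λs : List ℕ} → moves λs ≡ false → exchange λs ≡ λs
exchange-fixed fixed rewrite fixed = refl

data Shape (λs : List ℕ) : Set where
  fixed  : moves λs ≡ false → Shape λs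
  column : {k : ℕ} → ColumnShaped k λs → Shape λs
  row    : {k : ℕ} → RowShaped k λs → Shape λs

shape : {λs : List ℕ} → IsPartition λs → Shape λs
shape {λs} p with initial2Reps λs in i2 | isStaircase λs in st
... | false | _     = fixed (cong (λ b → b ∧ not (isStaircase λs)) i2)
... | true  | true  = fixed (cong₂ (λ a b → a ∧ not b) i2 st)
... | true  | false with firstPart λs ≤? length λs | initial2Reps⇒repeatsUpTo {λs} (from T-≡ i2)
...   | no  head≰len | r = row (rowShaped p r (≰⇒> head≰len))
...   | yes head≤len | r with maxRep λs | r
...     | suc k | r′ = column (columnShaped p r′ head≤len)
...     | zero  | r′ = contradiction (trans (sym (isStaircase⁺ (distinct⇒≡staircase p r′ head≤len))) st) λ ()

exchange-isPartition : {λs : List ℕ} → IsPartition λs → IsPartition (exchange λs)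
exchange-isPartition {λs} p with shape p
... | fixed m  = subst IsPartition (sym (exchange-fixed {λs} m)) p
... | column c = subst IsPartition (sym (exchange-columnShaped c))
                       (RowShaped.isPartition (columnToRow-rowShaped c))
... | row r    = subst IsPartition (sym (exchange-rowShaped r))
                       (ColumnShaped.isPartition (rowToColumn-columnShaped r))

sum-exchange : {λs : List ℕ} → IsPartition λs → sumℕ (exchange λs) ≡ sumℕ λs
sum-exchange {λs} p with shape p
... | fixed m  = cong sumℕ (exchange-fixed {λs} m)
... | column c = trans (cong sumℕ (exchange-columnShaped c)) (sum-columnToRow (positive p))
... | row r    = trans (cong sumℕ (exchange-rowShaped r)) (sum-rowToColumn r)

exchange-involutive : {λs : List ℕ} → IsPartition λs → exchange (exchange λs) ≡ λs
exchange-involutive {λs} p with shape p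
... | fixed m  = trans (cong exchange (exchange-fixed {λs} m)) (exchange-fixed {λs} m)
... | column c = begin
  exchange (exchange λs)       ≡⟨ cong exchange (exchange-columnShaped c) ⟩
  exchange (columnToRow λs)    ≡⟨ exchange-rowShaped (columnToRow-rowShaped c) ⟩
  rowToColumn (columnToRow λs) ≡⟨ rowToColumn-columnToRow p ⟩
  λs                           ∎
  where open ≡-Reasoning
... | row r    = begin
  exchange (exchange λs)       ≡⟨ cong exchange (exchange-rowShaped r) ⟩
  exchange (rowToColumn λs)    ≡⟨ exchange-columnShaped (rowToColumn-columnShaped r) ⟩
  columnToRow (rowToColumn λs) ≡⟨ columnToRow-rowToColumn r ⟩
  λs                           ∎
  where open ≡-Reasoning

even?-suc : (k : ℕ) → even? (suc k) ≡ not (even? k)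
even?-suc zero          = refl
even?-suc (suc zero)    = refl
even?-suc (suc (suc k)) = even?-suc k

bO-cond-fixed : {λs : List ℕ} → moves λs ≡ false → bO-cond λs ≡ bE-cond λs ∧ not (isStaircase λs)
bO-cond-fixed {λs} m with isStaircase λs in st
... | true  = trans (bO-cond≡odd? (isStaircase⇒repeatsUpTo-0 λs st)) (sym (∧-zeroʳ (bE-cond λs)))
... | false rewrite trans (sym (∧-identityʳ (initial2Reps λs))) m = refl

bO-cond-exchange : {λs : List ℕ} → IsPartition λs → bO-cond (exchange λs) ≡ bE-cond λs ∧ not (isStaircase λs)
bO-cond-exchange {λs} p with shape p
... | fixed m = trans (cong bO-cond (exchange-fixed {λs} m)) (bO-cond-fixed {λs} m)
... | column {k} c@(columnShaped _ r _) = begin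
  bO-cond (exchange λs)             ≡⟨ cong bO-cond (exchange-columnShaped c) ⟩
  bO-cond (columnToRow λs)          ≡⟨ bO-cond≡odd? (RowShaped.repeats (columnToRow-rowShaped c)) ⟩
  not (even? k)                     ≡⟨ even?-suc k ⟨
  even? (suc k)                     ≡⟨ bE-cond≡even? r ⟨
  bE-cond λs                        ≡⟨ ∧-identityʳ (bE-cond λs) ⟨
  bE-cond λs ∧ true                 ≡⟨ cong (λ b → bE-cond λs ∧ not b) (columnShaped-¬staircase c) ⟨
  bE-cond λs ∧ not (isStaircase λs) ∎
  where open ≡-Reasoning
... | row {k} r@(rowShaped _ rep _) = begin
  bO-cond (exchange λs)             ≡⟨ cong bO-cond (exchange-rowShaped r) ⟩
  bO-cond (rowToColumn λs)          ≡⟨ bO-cond≡odd? (ColumnShaped.repeats (rowToColumn-columnShaped r)) ⟩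
  not (even? (suc k))               ≡⟨ cong not (even?-suc k) ⟩
  not (not (even? k))               ≡⟨ not-involutive (even? k) ⟩
  even? k                           ≡⟨ bE-cond≡even? rep ⟨
  bE-cond λs                        ≡⟨ ∧-identityʳ (bE-cond λs) ⟨
  bE-cond λs ∧ true                 ≡⟨ cong (λ b → bE-cond λs ∧ not b) (rowShaped-¬staircase r) ⟨
  bE-cond λs ∧ not (isStaircase λs) ∎
  where open ≡-Reasoning

partitions-exchange : (n : ℕ) {λs : List ℕ} → λs ∈ partitions n → exchange λs ∈ partitions n
partitions-exchange n λs∈ with p , sum≡n ← ∈-partitions⁻ n λs∈ =
  ∈-partitions⁺ n (exchange-isPartition p) (trans (sum-exchange p) sum≡n)

bO≡ : (n : ℕ) → bO n ≡ countBy (λ λs → bE-cond λs ∧ not (isStaircase λs)) (partitions n)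
bO≡ n = begin
  countBy bO-cond (partitions n)
    ≡⟨ countBy-↭ bO-cond (map-involution-↭ exchange (partitions-unique n) (partitions-exchange n) involutive) ⟨
  countBy bO-cond (map exchange (partitions n))
    ≡⟨ countBy-map bO-cond exchange (partitions n) ⟩
  countBy (bO-cond ∘ exchange) (partitions n)
    ≡⟨ countBy-cong (partitions n) (bO-cond-exchange ∘ isPartition) ⟩
  countBy (λ λs → bE-cond λs ∧ not (isStaircase λs)) (partitions n) ∎
  where
  open ≡-Reasoning
  isPartition : ∀ {λs} → λs ∈ partitions n → IsPartition λs
  isPartition λs∈ with p , _ ← ∈-partitions⁻ n λs∈ = p
  involutive : ∀ {λs} → λs ∈ partitions n → exchange (exchange λs) ≡ λs
  involutive = exchange-involutive ∘ isPartition

bE-cond∧isStaircase : (λs : List ℕ) → bE-cond λs ∧ isStaircase λs ≡ isStaircase λs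
bE-cond∧isStaircase λs with isStaircase λs in st
... | true  = trans (∧-identityʳ (bE-cond λs)) (bE-cond≡even? (isStaircase⇒repeatsUpTo-0 λs st))
... | false = ∧-zeroʳ (bE-cond λs)

bE≡ : (n : ℕ) →
      bE n ≡ countBy (λ λs → bE-cond λs ∧ not (isStaircase λs)) (partitions n) + countBy isStaircase (partitions n)
bE≡ n = trans (countBy-∧-not+∧ bE-cond isStaircase (partitions n))
              (cong₂ _+_ refl (countBy-cong (partitions n) λ {λs} _ → bE-cond∧isStaircase λs))

[+[m+n]]-[+m]≡+n : (m n : ℕ) → + (m + n) - + m ≡ + n
[+[m+n]]-[+m]≡+n m n = trans ([+m]-[+n]≡m⊖n (m + n) m) (trans (⊖-≥ (m≤m+n m n)) (cong +_ (m+n∸m≡n m n)))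

bE-bO≡staircases : (n : ℕ) → (+ bE n) - (+ bO n) ≡ + countBy isStaircase (partitions n)
bE-bO≡staircases n = begin
  + bE n - + bO n                   ≡⟨ cong₂ (λ e o → + e - + o) (bE≡ n) (bO≡ n) ⟩
  + (moved + staircases) - + moved  ≡⟨ [+[m+n]]-[+m]≡+n moved staircases ⟩
  + staircases                      ∎
  where
  open ≡-Reasoning
  moved staircases : ℕ
  moved      = countBy (λ λs → bE-cond λs ∧ not (isStaircase λs)) (partitions n)
  staircases = countBy isStaircase (partitions n)

staircase-partition-triangular : (n : ℕ) {λs : List ℕ} → λs ∈ partitions n → isStaircase λs ≡ true →
                                 2 * n ≡ length λs * (length λs + 1)
staircase-partition-triangular n {λs} λs∈ st with _ , sum≡n ← ∈-partitions⁻ n λs∈ =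
  trans (cong (2 *_) (trans (sym sum≡n) (cong sumℕ (isStaircase⁻ λs st)))) (sum-staircase (length λs))

countBy-isStaircase-triangular : (n : ℕ) → Triangular n → countBy isStaircase (partitions n) ≡ 1
countBy-isStaircase-triangular n (j , 2n≡) =
  countBy-≡1 isStaircase (partitions-unique n) staircase∈ (isStaircase-staircase j) only
  where
  staircase∈ : staircase j ∈ partitions n
  staircase∈ =
    ∈-partitions⁺ n (staircase-isPartition j) (*-cancelˡ-≡ _ _ 2 (trans (sum-staircase j) (sym 2n≡)))
  only : ∀ {λs} → λs ∈ partitions n → isStaircase λs ≡ true → λs ≡ staircase j
  only {λs} λs∈ st = trans (isStaircase⁻ λs st)
    (cong staircase (triangular-injective (trans (sym (staircase-partition-triangular n λs∈ st)) 2n≡)))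

countBy-isStaircase-¬triangular : (n : ℕ) → ¬ Triangular n → countBy isStaircase (partitions n) ≡ 0
countBy-isStaircase-¬triangular n ¬tri = countBy-≡0 isStaircase (partitions n) none
  where
  none : ∀ {λs} → λs ∈ partitions n → isStaircase λs ≡ false
  none {λs} λs∈ with isStaircase λs in st
  ... | true  = contradiction (length λs , staircase-partition-triangular n λs∈ st) ¬tri
  ... | false = refl

mainTheorem2 : (n : ℕ) →
    (Triangular n → (+ bE n) - (+ bO n) ≡ + 1) × (¬ Triangular n → (+ bE n) - (+ bO n) ≡ + 0)
mainTheorem2 n =
    (λ tri  → trans (bE-bO≡staircases n) (cong +_ (countBy-isStaircase-triangular n tri)))
  , (λ ¬tri → trans (bE-bO≡staircases n) (cong +_ (countBy-isStaircase-¬triangular n ¬tri)))
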